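{- Let $q=p^{m_0}$, $A=\mathbb{F}_q[\theta]$, $t\in\mathbb{C}_\infty$, and let $\beta$ be a nonnegative integer. Let $\lambda>\beta$ be a positive integer with $\lambda\equiv-\beta\pmod{q-1}$. Then $L(\chi_t^\beta,s)=0$ at $s=-\lambda:=(\pi^{\lambda},-\lambda)\in\mathbb{S}_\infty$, where $\pi=1/\theta$; equivalently, $$\sum_{e=0}^\infty\ \sum_{a\in A_+(e)}\chi_t(a)^\beta a^{\lambda}=0$$ (the sum having only finitely many nonzero terms).
   Context: $\mathbb{C}_\infty$ is the completion of an algebraic closure of $\mathbb{F}_q((1/\theta))$. $A_+$ is the set of monic elements of $A$ and $A_+(e)$ those of degree $e$. For $a\in A_+$, $\langle a\rangle:=\pi^{\deg a}a$; $\mathbb{S}_\infty:=\mathbb{C}_\infty^\ast\times\mathbb{Z}_p$ and $a^{(x,y)}:=x^{\deg a}\langle a\rangle^y$. $\chi_t(f):=f(t)$ for $f\in A$. The Pellarin $L$-series $L(\chi_t^\beta,s)=\sum_{a\in A_+}\chi_t(a)^\beta a^{ -s}$ extends to an entire function on $\mathbb{S}_\infty$, given for $s=(x,y)$ by $\sum_{e\ge0}x^{ -e}\sum_{a\in A_+(e)}\chi_t(a)^\beta\langle a\rangle^{ -y}$; its value at $(\pi^\lambda,-\lambda)$ is the displayed sum. -}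

module Defs where

open import Level using (0ℓ)
open import Data.Nat using (ℕ; zero; suc; _≤_)
open import Data.Fin using (Fin)
open import Data.Vec using (Vec; []; _∷_)
open import Data.List using (List; [_]; map; concatMap; allFin; foldr)
open import Data.Product using (Σ; _×_)
open import Relation.Nullary using (¬_)
open import Relation.Binary.PropositionalEquality using (_≡_)
open import Algebra.Bundles using (CommutativeRing)

record FiniteField (q : ℕ) : Set₁ where
  field
    ring : CommutativeRing 0ℓ 0ℓ
  open CommutativeRing ring
  field
    0≉1       : ¬ (0# ≈ 1#)
    inverse   : ∀ x → ¬ (x ≈ 0#) → Σ Carrier (λ y → x * y ≈ 1#)
    enum      : Fin q → Carrier
    enum-inj  : ∀ i j → enum i ≈ enum j → i ≡ j
    enum-surj : ∀ x → Σ (Fin q) (λ i → enum i ≈ x)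

module _ (R : CommutativeRing 0ℓ 0ℓ) where
  open CommutativeRing R

  pow : Carrier → ℕ → Carrier
  pow x zero    = 1#
  pow x (suc n) = x * pow x n

  -- Evaluate the monic polynomial X^e + c₀ + c₁ X + … + c_{e-1} X^{e-1} at x
  -- (coefficients given as the vector c₀ ∷ c₁ ∷ … ∷ c_{e-1}).
  evalMonic : ∀ {e} → Vec Carrier e → Carrier → Carrier
  evalMonic []       x = 1#
  evalMonic (c ∷ cs) x = c + x * evalMonic cs x

  sumList : List Carrier → Carrier
  sumList = foldr _+_ 0#

  sumTo : ℕ → (ℕ → Carrier) → Carrier
  sumTo zero    f = 0#
  sumTo (suc n) f = sumTo n f + f n

  FinSuppSumZero : (ℕ → Carrier) → Set
  FinSuppSumZero f = Σ ℕ (λ N → (∀ e → N ≤ e → f e ≈ 0#) × (sumTo N f ≈ 0#))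

allVecs : (q e : ℕ) → List (Vec (Fin q) e)
allVecs q zero    = [ [] ]
allVecs q (suc e) = concatMap (λ i → map (i ∷_) (allVecs q e)) (allFin q)

mapVec : ∀ {A B : Set} {n} → (A → B) → Vec A n → Vec B n
mapVec f []       = []
mapVec f (x ∷ xs) = f x ∷ mapVec f xs

-- Given F = F_q, an F_q-algebra R (structure map ι), elements θ, t ∈ R and β, k:
-- the degree-e piece  Σ_{a ∈ A_+(e)} a(t)^β · a(θ)^k  ∈ R.
degreeSum : ∀ {q} (F : FiniteField q) (R : CommutativeRing 0ℓ 0ℓ)
            (ι : CommutativeRing.Carrier (FiniteField.ring F) → CommutativeRing.Carrier R)
            (θ t : CommutativeRing.Carrier R) (β k e : ℕ) → CommutativeRing.Carrier R
degreeSum {q} F R ι θ t β k e =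
  sumList R (map term (allVecs q e))
  where
    open CommutativeRing R
    term : Vec (Fin q) e → Carrier
    term c = let a = mapVec (λ i → ι (FiniteField.enum F i)) c in
             pow R (evalMonic R a t) β * pow R (evalMonic R a θ) k

module Submission where

-- Write Z d = Σ_{deg a < d} a(t)^β a(θ)^k and M d = Σ_{a monic, deg a = d} a(t)^β a(θ)^k, the
-- sums running over polynomials with coefficients in F_q (embedded into R).  The proof has
-- three ingredients.
--   * Vanishing of low-degree power sums (PolynomialSums.vanishing): since q · 1 = 0 in R,
--     Σ_{deg a < d} (α + a(x))^i (γ + a(y))^j = 0 for i + j < d.  Hence M d = Z d = 0 for
--     d > β + k, i.e. the series has finite support.
--   * Fermat's little theorem in F_q (FiniteFieldFacts.fermat), giving Σ_{u ∈ F_q} u^(k+β) = -1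
--     because (q - 1) ∣ k + β ≥ 1 (Embedding.power-sum).
--   * Splitting the polynomials of degree < d + 1 by their top coefficient u, where rescaling
--     by u ≠ 0 turns them into u times the monic ones, gives Z (d+1) = Z d + (Σ_u u^(k+β)) M d,
--     i.e. Z (d+1) + M d = Z d (SpecialValue.recurrence).
-- Telescoping from Z 0 = 0 then gives Σ_{d<N} M d = -Z N = 0 for N = β + k + 1.
-- The file develops finite sums (over Fin n and over lists), the uncollected binomial theorem,
-- sums over coefficient vectors, facts about F_q and its embedding into R, and finally the
-- special value itself.

open import Level using (0ℓ)
open import Data.Nat as ℕ using (ℕ; zero; suc; s≤s; z≤n; _∸_)
import Data.Nat.Properties as ℕ
open import Data.Nat.Properties using (≤-refl)
open import Data.Nat.Divisibility using (_∣_; divides)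
open import Data.Fin as Fin using (Fin)
open import Data.Fin.Properties using (punchInᵢ≢i)
open import Data.Fin.Permutation using (Permutation; _⟨$⟩ʳ_; permutation)
open import Data.List using (List; []; _∷_; map; allFin; tabulate; concatMap; cartesianProduct; _++_)
open import Data.List.Properties using (map-∘; map-tabulate)
open import Data.Product using (Σ; _×_; _,_; proj₁; proj₂)
open import Data.Maybe using (nothing)
open import Data.Empty using (⊥-elim)
open import Function using (_∘_)
open import Relation.Nullary using (¬_; yes; no)
open import Relation.Binary.PropositionalEquality as ≡ using (_≡_; _≢_)
open import Algebra.Bundles using (CommutativeMonoid; CommutativeRing)
open import Algebra.Morphism.Structures using (IsRingHomomorphism)
import Algebra.Properties.Semiring.Exp
open import Defs

module MonoidFacts (M : CommutativeMonoid 0ℓ 0ℓ) where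
  open CommutativeMonoid M
  open import Algebra.Properties.CommutativeMonoid.Sum M
    using (sum; sum-remove; sum-cong-≋; ∑-distrib-+; sum-replicate-zero)
  open import Algebra.Properties.CommutativeSemigroup commutativeSemigroup using (xy∙z≈zy∙x)
  open import Relation.Binary.Reasoning.Setoid setoid

  sum-differ-at : ∀ {n} (z : Fin n) {f g : Fin n → Carrier} →
                  (∀ u → u ≢ z → f u ≈ g u) → sum f ∙ g z ≈ sum g ∙ f z
  sum-differ-at {suc n} z {f} {g} agree = begin
    sum f ∙ g z                        ≈⟨ ∙-congʳ (sum-remove f) ⟩
    (f z ∙ sum (f ∘ Fin.punchIn z)) ∙ g z
      ≈⟨ ∙-congʳ (∙-congˡ (sum-cong-≋ λ j → agree _ (punchInᵢ≢i z j))) ⟩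
    (f z ∙ sum (g ∘ Fin.punchIn z)) ∙ g z ≈⟨ xy∙z≈zy∙x _ _ _ ⟩
    (g z ∙ sum (g ∘ Fin.punchIn z)) ∙ f z ≈⟨ ∙-congʳ (sum-remove g) ⟨
    sum g ∙ f z                        ∎

  sum-invertible : ∀ {n} (f : Fin n → Carrier) → (∀ u → Σ Carrier λ v → f u ∙ v ≈ ε) →
                   Σ Carrier λ w → sum f ∙ w ≈ ε
  sum-invertible {n} f inv = sum (proj₁ ∘ inv) , (begin
    sum f ∙ sum (proj₁ ∘ inv)         ≈⟨ ∑-distrib-+ f (proj₁ ∘ inv) ⟨
    sum (λ u → f u ∙ proj₁ (inv u))   ≈⟨ sum-cong-≋ (proj₂ ∘ inv) ⟩
    sum {n} (λ _ → ε)                 ≈⟨ sum-replicate-zero n ⟩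
    ε                                 ∎)

  cancel : ∀ {a w x y} → a ∙ w ≈ ε → a ∙ x ≈ a ∙ y → x ≈ y
  cancel {a} {w} {x} {y} aw≈ε ax≈ay = begin
    x            ≈⟨ identityˡ x ⟨
    ε ∙ x        ≈⟨ ∙-congʳ (trans (comm w a) aw≈ε) ⟨
    (w ∙ a) ∙ x  ≈⟨ assoc w a x ⟩
    w ∙ (a ∙ x)  ≈⟨ ∙-congˡ ax≈ay ⟩
    w ∙ (a ∙ y)  ≈⟨ assoc w a y ⟨
    (w ∙ a) ∙ y  ≈⟨ ∙-congʳ (trans (comm w a) aw≈ε) ⟩
    ε ∙ y        ≈⟨ identityˡ y ⟩
    y            ∎

module ListSum (R : CommutativeRing 0ℓ 0ℓ) where
  open CommutativeRing R
  open import Relation.Binary.Reasoning.Setoid setoid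
  open import Algebra.Properties.CommutativeSemigroup +-commutativeSemigroup
    using (interchange)
  import Algebra.Properties.CommutativeMonoid.Sum +-commutativeMonoid as Fin-Σ
  module +-MonoidFacts = MonoidFacts +-commutativeMonoid

  sumOver : {A : Set} → List A → (A → Carrier) → Carrier
  sumOver xs f = sumList R (map f xs)

  syntax sumOver xs (λ x → e) = ∑[ x ∈ xs ] e

  module _ {A : Set} where

    sum-cong : ∀ (xs : List A) {f g : A → Carrier} → (∀ x → f x ≈ g x) → ∑[ x ∈ xs ] f x ≈ ∑[ x ∈ xs ] g x
    sum-cong []       f≈g = refl
    sum-cong (x ∷ xs) f≈g = +-cong (f≈g x) (sum-cong xs f≈g)

    sum-zero : ∀ (xs : List A) {f : A → Carrier} → (∀ x → f x ≈ 0#) → ∑[ x ∈ xs ] f x ≈ 0#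
    sum-zero []       f≈0 = refl
    sum-zero (x ∷ xs) f≈0 = trans (+-cong (f≈0 x) (sum-zero xs f≈0)) (+-identityˡ 0#)

    sum-+ : ∀ (xs : List A) (f g : A → Carrier) →
            ∑[ x ∈ xs ] (f x + g x) ≈ ∑[ x ∈ xs ] f x + ∑[ x ∈ xs ] g x
    sum-+ []       f g = sym (+-identityˡ 0#)
    sum-+ (x ∷ xs) f g = trans (+-congˡ (sum-+ xs f g)) (interchange _ _ _ _)

    sum-*ˡ : ∀ (xs : List A) r (f : A → Carrier) → ∑[ x ∈ xs ] (r * f x) ≈ r * ∑[ x ∈ xs ] f x
    sum-*ˡ []       r f = sym (zeroʳ r)
    sum-*ˡ (x ∷ xs) r f = trans (+-congˡ (sum-*ˡ xs r f)) (sym (distribˡ r _ _))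

    sum-*ʳ : ∀ (xs : List A) r (f : A → Carrier) → ∑[ x ∈ xs ] (f x * r) ≈ ∑[ x ∈ xs ] f x * r
    sum-*ʳ xs r f = begin
      ∑[ x ∈ xs ] (f x * r)  ≈⟨ sum-cong xs (λ x → *-comm (f x) r) ⟩
      ∑[ x ∈ xs ] (r * f x)  ≈⟨ sum-*ˡ xs r f ⟩
      r * ∑[ x ∈ xs ] f x    ≈⟨ *-comm r _ ⟩
      ∑[ x ∈ xs ] f x * r    ∎

    sum-++ : ∀ (xs ys : List A) (f : A → Carrier) →
             ∑[ x ∈ xs ++ ys ] f x ≈ ∑[ x ∈ xs ] f x + ∑[ x ∈ ys ] f x
    sum-++ []       ys f = sym (+-identityˡ _)
    sum-++ (x ∷ xs) ys f = trans (+-congˡ (sum-++ xs ys f)) (sym (+-assoc _ _ _))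

  sum-map : ∀ {A B : Set} (xs : List A) (g : A → B) (f : B → Carrier) →
            ∑[ y ∈ map g xs ] f y ≡ ∑[ x ∈ xs ] f (g x)
  sum-map xs g f = ≡.cong (sumList R) (≡.sym (map-∘ xs))

  sum-concatMap : ∀ {A B : Set} (xs : List A) (h : A → List B) (f : B → Carrier) →
                  ∑[ y ∈ concatMap h xs ] f y ≈ ∑[ x ∈ xs ] ∑[ y ∈ h x ] f y
  sum-concatMap []       h f = refl
  sum-concatMap (x ∷ xs) h f = trans (sum-++ (h x) (concatMap h xs) f) (+-congˡ (sum-concatMap xs h f))

  sum-swap : ∀ {A B : Set} (xs : List A) (ys : List B) (H : A → B → Carrier) →
             ∑[ x ∈ xs ] ∑[ y ∈ ys ] H x y ≈ ∑[ y ∈ ys ] ∑[ x ∈ xs ] H x y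
  sum-swap []       ys H = sym (sum-zero ys (λ _ → refl))
  sum-swap (x ∷ xs) ys H = trans (+-congˡ (sum-swap xs ys H)) (sym (sum-+ ys (H x) _))

  sum-product : ∀ {A B : Set} (xs : List A) (ys : List B) (f : A → Carrier) (g : B → Carrier) →
                ∑[ x ∈ xs ] f x * ∑[ y ∈ ys ] g y ≈ ∑[ p ∈ cartesianProduct xs ys ] (f (proj₁ p) * g (proj₂ p))
  sum-product []       ys f g = zeroˡ _
  sum-product (x ∷ xs) ys f g = begin
    (f x + ∑[ x ∈ xs ] f x) * ∑[ y ∈ ys ] g y
      ≈⟨ distribʳ _ _ _ ⟩
    f x * ∑[ y ∈ ys ] g y + ∑[ x ∈ xs ] f x * ∑[ y ∈ ys ] g y
      ≈⟨ +-cong (sym (sum-*ˡ ys (f x) g)) (sum-product xs ys f g) ⟩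
    ∑[ y ∈ ys ] (f x * g y) + ∑[ p ∈ cartesianProduct xs ys ] (f (proj₁ p) * g (proj₂ p))
      ≡⟨ ≡.cong (_+ _) (≡.sym (sum-map ys (x ,_) _)) ⟩
    ∑[ p ∈ map (x ,_) ys ] (f (proj₁ p) * g (proj₂ p)) + ∑[ p ∈ cartesianProduct xs ys ] (f (proj₁ p) * g (proj₂ p))
      ≈⟨ sum-++ (map (x ,_) ys) _ _ ⟨
    ∑[ p ∈ cartesianProduct (x ∷ xs) ys ] (f (proj₁ p) * g (proj₂ p)) ∎

  sum-allFin : ∀ n (f : Fin n → Carrier) → ∑[ u ∈ allFin n ] f u ≡ Fin-Σ.sum f
  sum-allFin n f = ≡.trans (≡.cong (sumList R) (map-tabulate (λ u → u) f)) (sumList-tabulate n f)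
    where
      sumList-tabulate : ∀ n (f : Fin n → Carrier) → sumList R (tabulate f) ≡ Fin-Σ.sum f
      sumList-tabulate zero    f = ≡.refl
      sumList-tabulate (suc n) f = ≡.cong (f Fin.zero +_) (sumList-tabulate n (f ∘ Fin.suc))

  sum-permute : ∀ {n} (π : Permutation n n) (f : Fin n → Carrier) →
                ∑[ u ∈ allFin n ] f (π ⟨$⟩ʳ u) ≈ ∑[ u ∈ allFin n ] f u
  sum-permute {n} π f = begin
    ∑[ u ∈ allFin n ] f (π ⟨$⟩ʳ u) ≡⟨ sum-allFin n _ ⟩
    Fin-Σ.sum (f ∘ (π ⟨$⟩ʳ_))     ≈⟨ Fin-Σ.sum-permute f π ⟨
    Fin-Σ.sum f                   ≡⟨ sum-allFin n f ⟨
    ∑[ u ∈ allFin n ] f u         ∎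

  sum-differ-at : ∀ {n} (z : Fin n) {f g : Fin n → Carrier} → (∀ u → u ≢ z → f u ≈ g u) →
                  ∑[ u ∈ allFin n ] f u + g z ≈ ∑[ u ∈ allFin n ] g u + f z
  sum-differ-at {n} z {f} {g} agree = begin
    ∑[ u ∈ allFin n ] f u + g z  ≡⟨ ≡.cong (_+ g z) (sum-allFin n f) ⟩
    Fin-Σ.sum f + g z            ≈⟨ +-MonoidFacts.sum-differ-at z agree ⟩
    Fin-Σ.sum g + f z            ≡⟨ ≡.cong (_+ f z) (sum-allFin n g) ⟨
    ∑[ u ∈ allFin n ] g u + f z  ∎

  sumTo-cong : ∀ N {f g : ℕ → Carrier} → (∀ d → f d ≈ g d) → sumTo R N f ≈ sumTo R N g
  sumTo-cong zero    f≈g = refl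
  sumTo-cong (suc N) f≈g = +-cong (sumTo-cong N f≈g) (f≈g N)

  finSuppSumZero-cong : ∀ {f g : ℕ → Carrier} → (∀ d → f d ≈ g d) → FinSuppSumZero R g → FinSuppSumZero R f
  finSuppSumZero-cong f≈g (N , g-vanishes , g-sum) =
    N , (λ d N≤d → trans (f≈g d) (g-vanishes d N≤d)) , trans (sumTo-cong N f≈g) g-sum

module Monomials where
  open import Data.Nat.Properties
    using (+-suc; m<n+m; ≤-pred; module ≤-Reasoning; +-commutativeSemigroup)
  open import Algebra.Properties.CommutativeSemigroup +-commutativeSemigroup
    using (interchange)

  record Monomial (i : ℕ) : Set where
    constructor monomial
    field
      xdeg ydeg : ℕ
      degree    : xdeg ℕ.+ ydeg ≡ i

  open Monomial public

  timesX timesY : ∀ {i} → Monomial i → Monomial (suc i)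
  timesX (monomial m a eq) = monomial (suc m) a (≡.cong suc eq)
  timesY (monomial m a eq) = monomial m (suc a) (≡.trans (+-suc m a) (≡.cong suc eq))

  -- The 2^i monomials of (x + y)^i, one per word in {x, y}^i (terms not collected).
  expansion : ∀ i → List (Monomial i)
  expansion zero    = monomial 0 0 ≡.refl ∷ []
  expansion (suc i) = map timesX (expansion i) ++ map timesY (expansion i)

  degree-drop : ∀ {i j d} (μ : Monomial i) (ν : Monomial j) → i ℕ.+ j ℕ.< suc d →
                0 ℕ.< xdeg μ ℕ.+ xdeg ν → ydeg μ ℕ.+ ydeg ν ℕ.< d
  degree-drop {i} {j} {d} (monomial m a m+a≡i) (monomial m′ b m′+b≡j) i+j<1+d x-occurs = begin-strict
    a ℕ.+ b                    <⟨ m<n+m (a ℕ.+ b) x-occurs ⟩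
    (m ℕ.+ m′) ℕ.+ (a ℕ.+ b)   ≡⟨ interchange m m′ a b ⟩
    (m ℕ.+ a) ℕ.+ (m′ ℕ.+ b)   ≡⟨ ≡.cong₂ ℕ._+_ m+a≡i m′+b≡j ⟩
    i ℕ.+ j                    ≤⟨ ≤-pred i+j<1+d ⟩
    d                          ∎
    where open ≤-Reasoning

module Expansion (R : CommutativeRing 0ℓ 0ℓ) where
  open CommutativeRing R hiding (zero)
  open import Algebra.Properties.Semiring.Exp semiring using (_^_)
  open import Algebra.Properties.CommutativeSemigroup *-commutativeSemigroup using (x∙yz≈y∙xz)
  open import Relation.Binary.Reasoning.Setoid setoid
  open ListSum R
  open Monomials

  evalMonomial : ∀ {i} → Carrier → Carrier → Monomial i → Carrier
  evalMonomial x y μ = x ^ xdeg μ * y ^ ydeg μ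

  binomial : ∀ i x y → (x + y) ^ i ≈ ∑[ μ ∈ expansion i ] evalMonomial x y μ
  binomial zero    x y = sym (trans (+-identityʳ _) (*-identityˡ 1#))
  binomial (suc i) x y = begin
    (x + y) * (x + y) ^ i
      ≈⟨ *-congˡ (binomial i x y) ⟩
    (x + y) * ∑[ μ ∈ Es ] ev μ
      ≈⟨ distribʳ _ x y ⟩
    x * ∑[ μ ∈ Es ] ev μ + y * ∑[ μ ∈ Es ] ev μ
      ≈⟨ +-cong (sum-*ˡ Es x ev) (sum-*ˡ Es y ev) ⟨
    ∑[ μ ∈ Es ] (x * ev μ) + ∑[ μ ∈ Es ] (y * ev μ)
      ≈⟨ +-cong (sum-cong Es λ μ → sym (*-assoc x _ _)) (sum-cong Es λ μ → x∙yz≈y∙xz y _ _) ⟩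
    ∑[ μ ∈ Es ] ev (timesX μ) + ∑[ μ ∈ Es ] ev (timesY μ)
      ≡⟨ ≡.cong₂ _+_ (sum-map Es timesX ev) (sum-map Es timesY ev) ⟨
    ∑[ μ ∈ map timesX Es ] ev μ + ∑[ μ ∈ map timesY Es ] ev μ
      ≈⟨ sum-++ (map timesX Es) (map timesY Es) ev ⟨
    ∑[ μ ∈ expansion (suc i) ] ev μ ∎
    where
      Es = expansion i
      ev : ∀ {j} → Monomial j → Carrier
      ev = evalMonomial x y

-- Sums over all polynomials of degree < d whose coefficients range over a family
-- e : Fin q → R (later the embedded elements of F_q), indexed by coefficient vectors.
module PolynomialSums (R : CommutativeRing 0ℓ 0ℓ) {q : ℕ} (e : Fin q → CommutativeRing.Carrier R) where
  open CommutativeRing R hiding (zero)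
  open import Algebra.Properties.Semiring.Exp semiring using (_^_; ^-congˡ)
  open import Algebra.Properties.CommutativeSemiring.Exp commutativeSemiring using (^-distrib-*)
  open import Algebra.Properties.CommutativeSemigroup *-commutativeSemigroup using (interchange; x∙yz≈y∙xz)
  open import Data.Vec using (Vec; []; _∷_; _∷ʳ_)
  open import Data.Sum using (_⊎_; inj₁; inj₂)
  open import Relation.Binary.Reasoning.Setoid setoid
  open import Algebra.Solver.Ring.NaturalCoefficients commutativeSemiring (λ _ _ → nothing)
  open ListSum R
  open Monomials
  open Expansion R

  -- The coefficient vector c = (c₀, …, c_{d-1}) encodes the polynomial Σᵢ e(cᵢ) Xⁱ of
  -- degree < d; value c x is its value at x (Horner's scheme).
  value : ∀ {d} → Vec (Fin q) d → Carrier → Carrier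
  value []       x = 0#
  value (c ∷ cs) x = e c + x * value cs x

  evalMonic-value : ∀ {d} (c : Vec (Fin q) d) x → evalMonic R (mapVec e c) x ≈ x ^ d + value c x
  evalMonic-value []       x = sym (+-identityʳ 1#)
  evalMonic-value {suc d} (c ∷ cs) x = begin
    e c + x * evalMonic R (mapVec e cs) x ≈⟨ +-congˡ (*-congˡ (evalMonic-value cs x)) ⟩
    e c + x * (x ^ d + value cs x)        ≈⟨ solve 4 (λ a x p v → a :+ x :* (p :+ v) := x :* p :+ (a :+ x :* v)) refl (e c) x (x ^ d) (value cs x) ⟩
    x * x ^ d + (e c + x * value cs x)    ∎

  value-snoc : ∀ {d} (c : Vec (Fin q) d) u x → value (c ∷ʳ u) x ≈ value c x + e u * x ^ d
  value-snoc []       u x = begin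
    e u + x * 0#     ≈⟨ trans (+-congˡ (zeroʳ x)) (+-identityʳ (e u)) ⟩
    e u              ≈⟨ trans (+-identityˡ _) (*-identityʳ (e u)) ⟨
    0# + e u * 1#    ∎
  value-snoc {suc d} (c ∷ cs) u x = begin
    e c + x * value (cs ∷ʳ u) x             ≈⟨ +-congˡ (*-congˡ (value-snoc cs u x)) ⟩
    e c + x * (value cs x + e u * x ^ d)    ≈⟨ solve 5 (λ a x v b p → a :+ x :* (v :+ b :* p) := a :+ x :* v :+ b :* (x :* p)) refl (e c) x (value cs x) (e u) (x ^ d) ⟩
    e c + x * value cs x + e u * (x * x ^ d) ∎

  value-scale : ∀ (π : Fin q → Fin q) y → (∀ j → e (π j) ≈ y * e j) →
                ∀ {d} (c : Vec (Fin q) d) x → value (mapVec π c) x ≈ y * value c x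
  value-scale π y scales []       x = sym (zeroʳ y)
  value-scale π y scales (c ∷ cs) x = begin
    e (π c) + x * value (mapVec π cs) x ≈⟨ +-cong (scales c) (*-congˡ (value-scale π y scales cs x)) ⟩
    y * e c + x * (y * value cs x)      ≈⟨ +-congˡ (x∙yz≈y∙xz x y _) ⟩
    y * e c + y * (x * value cs x)      ≈⟨ distribˡ y _ _ ⟨
    y * (e c + x * value cs x)          ∎

  sum-cons : ∀ d (G : Vec (Fin q) (suc d) → Carrier) →
             ∑[ c ∈ allVecs q (suc d) ] G c ≈ ∑[ u ∈ allFin q ] ∑[ c ∈ allVecs q d ] G (u ∷ c)
  sum-cons d G = trans (sum-concatMap (allFin q) (λ u → map (u ∷_) (allVecs q d)) G)
                       (sum-cong (allFin q) λ u → reflexive (sum-map (allVecs q d) (u ∷_) G))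

  sum-snoc : ∀ d (G : Vec (Fin q) (suc d) → Carrier) →
             ∑[ c ∈ allVecs q (suc d) ] G c ≈ ∑[ c ∈ allVecs q d ] ∑[ u ∈ allFin q ] G (c ∷ʳ u)
  sum-snoc zero    G = trans (sum-cons zero G)
                             (trans (sum-cong (allFin q) λ u → +-identityʳ _) (sym (+-identityʳ _)))
  sum-snoc (suc d) G = begin
    ∑[ c ∈ allVecs q (suc (suc d)) ] G c
      ≈⟨ sum-cons (suc d) G ⟩
    ∑[ w ∈ allFin q ] ∑[ c ∈ allVecs q (suc d) ] G (w ∷ c)
      ≈⟨ sum-cong (allFin q) (λ w → sum-snoc d (λ c → G (w ∷ c))) ⟩
    ∑[ w ∈ allFin q ] ∑[ c ∈ allVecs q d ] ∑[ u ∈ allFin q ] G (w ∷ (c ∷ʳ u))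
      ≈⟨ sum-cons d (λ c → ∑[ u ∈ allFin q ] G (c ∷ʳ u)) ⟨
    ∑[ c ∈ allVecs q (suc d) ] ∑[ u ∈ allFin q ] G (c ∷ʳ u) ∎

  sum-reindex : ∀ (π : Permutation q q) d (G : Vec (Fin q) d → Carrier) →
                ∑[ c ∈ allVecs q d ] G (mapVec (π ⟨$⟩ʳ_) c) ≈ ∑[ c ∈ allVecs q d ] G c
  sum-reindex π zero    G = refl
  sum-reindex π (suc d) G = begin
    ∑[ c ∈ allVecs q (suc d) ] G (mapVec (π ⟨$⟩ʳ_) c)
      ≈⟨ sum-cons d _ ⟩
    ∑[ u ∈ allFin q ] ∑[ c ∈ allVecs q d ] G ((π ⟨$⟩ʳ u) ∷ mapVec (π ⟨$⟩ʳ_) c)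
      ≈⟨ sum-cong (allFin q) (λ u → sum-reindex π d (λ c → G ((π ⟨$⟩ʳ u) ∷ c))) ⟩
    ∑[ u ∈ allFin q ] ∑[ c ∈ allVecs q d ] G ((π ⟨$⟩ʳ u) ∷ c)
      ≈⟨ sum-permute π (λ u → ∑[ c ∈ allVecs q d ] G (u ∷ c)) ⟩
    ∑[ u ∈ allFin q ] ∑[ c ∈ allVecs q d ] G (u ∷ c)
      ≈⟨ sum-cons d G ⟨
    ∑[ c ∈ allVecs q (suc d) ] G c ∎

  sum-separated : ∀ {d} {K : Set} (ks : List K) (G : Vec (Fin q) (suc d) → Carrier)
                  (f : K → Fin q → Carrier) (g : K → Vec (Fin q) d → Carrier) →
                  (∀ u c → G (u ∷ c) ≈ ∑[ κ ∈ ks ] (f κ u * g κ c)) →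
                  (∀ κ → ∑[ u ∈ allFin q ] f κ u ≈ 0# ⊎ ∑[ c ∈ allVecs q d ] g κ c ≈ 0#) →
                  ∑[ c ∈ allVecs q (suc d) ] G c ≈ 0#
  sum-separated {d} ks G f g split factor-vanishes = begin
    ∑[ c ∈ allVecs q (suc d) ] G c
      ≈⟨ sum-cons d G ⟩
    ∑[ u ∈ Fq ] ∑[ c ∈ Vs ] G (u ∷ c)
      ≈⟨ sum-cong Fq (λ u → sum-cong Vs (split u)) ⟩
    ∑[ u ∈ Fq ] ∑[ c ∈ Vs ] ∑[ κ ∈ ks ] (f κ u * g κ c)
      ≈⟨ sum-cong Fq (λ u → sum-swap Vs ks _) ⟩
    ∑[ u ∈ Fq ] ∑[ κ ∈ ks ] ∑[ c ∈ Vs ] (f κ u * g κ c)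
      ≈⟨ sum-swap Fq ks _ ⟩
    ∑[ κ ∈ ks ] ∑[ u ∈ Fq ] ∑[ c ∈ Vs ] (f κ u * g κ c)
      ≈⟨ sum-cong ks (λ κ → trans (sum-cong Fq λ u → sum-*ˡ Vs (f κ u) (g κ)) (sum-*ʳ Fq _ (f κ))) ⟩
    ∑[ κ ∈ ks ] (∑[ u ∈ Fq ] f κ u * ∑[ c ∈ Vs ] g κ c)
      ≈⟨ sum-zero ks (λ κ → product-vanishes (factor-vanishes κ)) ⟩
    0# ∎
    where
      Fq = allFin q
      Vs = allVecs q d
      product-vanishes : ∀ {a b} → a ≈ 0# ⊎ b ≈ 0# → a * b ≈ 0#
      product-vanishes (inj₁ a≈0) = trans (*-congʳ a≈0) (zeroˡ _)
      product-vanishes (inj₂ b≈0) = trans (*-congˡ b≈0) (zeroʳ _)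

  unshifted : ∀ d i j x y {r} →
              ∑[ c ∈ allVecs q d ] ((0# + value c x) ^ i * (0# + value c y) ^ j) ≈ r →
              ∑[ c ∈ allVecs q d ] (value c x ^ i * value c y ^ j) ≈ r
  unshifted d i j x y = trans (sum-cong (allVecs q d) λ c →
    *-cong (^-congˡ i (sym (+-identityˡ _))) (^-congˡ j (sym (+-identityˡ _))))

  -- Induction on d:
  -- split off the constant coefficient u, expand both powers binomially, and separate u
  -- from the remaining coefficients; a term free of u sums to a multiple of q · 1, every
  -- other term has degree < d in the remaining coefficients.
  vanishing : ∑[ u ∈ allFin q ] 1# ≈ 0# →
              ∀ d i j → i ℕ.+ j ℕ.< d → ∀ x y α γ →
              ∑[ c ∈ allVecs q d ] ((α + value c x) ^ i * (γ + value c y) ^ j) ≈ 0#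
  vanishing q≈0 zero    i j ()
  vanishing q≈0 (suc d) i j i+j<1+d x y α γ =
    sum-separated pairs _ f g expand separate
    where
      pairs : List (Monomial i × Monomial j)
      pairs = cartesianProduct (expansion i) (expansion j)

      f : Monomial i × Monomial j → Fin q → Carrier
      f (μ , ν) u = (α + e u) ^ xdeg μ * (γ + e u) ^ xdeg ν

      g : Monomial i × Monomial j → Vec (Fin q) d → Carrier
      g (μ , ν) c = (x * value c x) ^ ydeg μ * (y * value c y) ^ ydeg ν

      expand : ∀ u c → (α + value (u ∷ c) x) ^ i * (γ + value (u ∷ c) y) ^ j ≈
                       ∑[ κ ∈ pairs ] (f κ u * g κ c)
      expand u c = begin
        (α + (e u + x * value c x)) ^ i * (γ + (e u + y * value c y)) ^ j
          ≈⟨ *-cong (^-congˡ i (sym (+-assoc _ _ _))) (^-congˡ j (sym (+-assoc _ _ _))) ⟩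
        ((α + e u) + x * value c x) ^ i * ((γ + e u) + y * value c y) ^ j
          ≈⟨ *-cong (binomial i _ _) (binomial j _ _) ⟩
        ∑[ μ ∈ expansion i ] evalMonomial (α + e u) (x * value c x) μ *
        ∑[ ν ∈ expansion j ] evalMonomial (γ + e u) (y * value c y) ν
          ≈⟨ sum-product (expansion i) (expansion j) _ _ ⟩
        ∑[ κ ∈ pairs ] (evalMonomial (α + e u) (x * value c x) (proj₁ κ) *
                        evalMonomial (γ + e u) (y * value c y) (proj₂ κ))
          ≈⟨ sum-cong pairs (λ κ → interchange _ _ _ _) ⟩
        ∑[ κ ∈ pairs ] (f κ u * g κ c) ∎

      -- If the u-factor is not constant, the c-factor has degree < d and vanishes by induction.
      higher-vanishes : ∀ κ → 0 ℕ.< xdeg (proj₁ κ) ℕ.+ xdeg (proj₂ κ) → ∑[ c ∈ allVecs q d ] g κ c ≈ 0#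
      higher-vanishes (μ , ν) occurs = begin
        ∑[ c ∈ allVecs q d ] g (μ , ν) c
          ≈⟨ sum-cong (allVecs q d) (λ c → trans (*-cong (^-distrib-* x _ a) (^-distrib-* y _ b)) (interchange _ _ _ _)) ⟩
        ∑[ c ∈ allVecs q d ] (x ^ a * y ^ b * (value c x ^ a * value c y ^ b))
          ≈⟨ sum-*ˡ (allVecs q d) _ _ ⟩
        x ^ a * y ^ b * ∑[ c ∈ allVecs q d ] (value c x ^ a * value c y ^ b)
          ≈⟨ *-congˡ (unshifted d a b x y (vanishing q≈0 d a b (degree-drop μ ν i+j<1+d occurs) x y 0# 0#)) ⟩
        x ^ a * y ^ b * 0#
          ≈⟨ zeroʳ _ ⟩
        0# ∎
        where
          a = ydeg μ
          b = ydeg ν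

      -- Otherwise the summand is 1 for every u, and Σ_u 1 = 0.
      separate : ∀ κ → ∑[ u ∈ allFin q ] f κ u ≈ 0# ⊎ ∑[ c ∈ allVecs q d ] g κ c ≈ 0#
      separate (monomial zero _ _ , monomial zero _ _) =
        inj₁ (trans (sum-cong (allFin q) λ u → *-identityˡ 1#) q≈0)
      separate κ@(monomial (suc _) _ _ , _) = inj₂ (higher-vanishes κ (s≤s z≤n))
      separate κ@(monomial zero _ _ , monomial (suc _) _ _) = inj₂ (higher-vanishes κ (s≤s z≤n))

module FiniteFieldFacts {q : ℕ} (F : FiniteField q) where
  open FiniteField F
  open CommutativeRing ring hiding (zero)
  open import Algebra.Properties.Semiring.Exp semiring using (_^_; ^-congˡ; ^-congʳ; ^-assocʳ)
  open import Relation.Binary.Reasoning.Setoid setoid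
  import Algebra.Properties.CommutativeMonoid.Sum *-commutativeMonoid as Π
  open MonoidFacts *-commutativeMonoid using (sum-differ-at; sum-invertible; cancel)

  zeroIndex : Fin q
  zeroIndex = proj₁ (enum-surj 0#)

  enum-zeroIndex : enum zeroIndex ≈ 0#
  enum-zeroIndex = proj₂ (enum-surj 0#)

  zeroIndex-unique : ∀ u → enum u ≈ 0# → u ≡ zeroIndex
  zeroIndex-unique u u≈0 = enum-inj u zeroIndex (trans u≈0 (sym enum-zeroIndex))

  q≡1+[q-1] : q ≡ suc (q ∸ 1)
  q≡1+[q-1] = nonempty zeroIndex
    where
      nonempty : ∀ {n} → Fin n → n ≡ suc (n ∸ 1)
      nonempty {suc n} _ = ≡.refl

  no-zero-divisors : ∀ {y x} → ¬ (y ≈ 0#) → y * x ≈ 0# → x ≈ 0#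
  no-zero-divisors {y} {x} y≉0 yx≈0 =
    cancel (proj₂ (inverse y y≉0)) (trans yx≈0 (sym (zeroʳ y)))

  permutationOf : (φ ψ : Carrier → Carrier) →
                  (∀ {x y} → x ≈ y → φ x ≈ φ y) → (∀ {x y} → x ≈ y → ψ x ≈ ψ y) →
                  (∀ x → φ (ψ x) ≈ x) → (∀ x → ψ (φ x) ≈ x) →
                  Σ (Permutation q q) λ π → ∀ u → enum (π ⟨$⟩ʳ u) ≈ φ (enum u)
  permutationOf φ ψ φ-cong ψ-cong φψ ψφ =
    permutation (lift φ) (lift ψ) (inverse-lift φ-cong φψ) (inverse-lift ψ-cong ψφ) ,
    λ u → proj₂ (enum-surj (φ (enum u)))
    where
      lift : (Carrier → Carrier) → Fin q → Fin q
      lift h u = proj₁ (enum-surj (h (enum u)))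
      inverse-lift : ∀ {h k} → (∀ {x y} → x ≈ y → h x ≈ h y) → (∀ x → h (k x) ≈ x) →
                     ∀ u → lift h (lift k u) ≡ u
      inverse-lift {h} {k} h-cong hk u = enum-inj _ _ (begin
        enum (lift h (lift k u)) ≈⟨ proj₂ (enum-surj _) ⟩
        h (enum (lift k u))      ≈⟨ h-cong (proj₂ (enum-surj _)) ⟩
        h (k (enum u))           ≈⟨ hk (enum u) ⟩
        enum u                   ∎)

  translation : Σ (Permutation q q) λ π → ∀ u → enum (π ⟨$⟩ʳ u) ≈ enum u + 1#
  translation = permutationOf (_+ 1#) (_+ - 1#) +-congʳ +-congʳ (shift (-‿inverseʳ 1#)) (shift (-‿inverseˡ 1#))
    where
      shift : ∀ {a b} → a + b ≈ 0# → ∀ x → x + b + a ≈ x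
      shift {a} {b} a+b≈0 x = trans (+-assoc x b a) (trans (+-congˡ (trans (+-comm b a) a+b≈0)) (+-identityʳ x))

  scaling : ∀ y → ¬ (y ≈ 0#) → Σ (Permutation q q) λ π → ∀ u → enum (π ⟨$⟩ʳ u) ≈ y * enum u
  scaling y y≉0 = permutationOf (y *_) (y⁻¹ *_) *-congˡ *-congˡ (undo yy⁻¹≈1) (undo (trans (*-comm y⁻¹ y) yy⁻¹≈1))
    where
      y⁻¹ = proj₁ (inverse y y≉0)
      yy⁻¹≈1 = proj₂ (inverse y y≉0)
      undo : ∀ {a b} → a * b ≈ 1# → ∀ x → a * (b * x) ≈ x
      undo {a} {b} ab≈1 x = trans (sym (*-assoc a b x)) (trans (*-congʳ ab≈1) (*-identityˡ x))

  -- u ↦ enum u, with 0 replaced by 1: a family of units of F.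
  nonzeroPart : Fin q → Carrier
  nonzeroPart u with u Fin.≟ zeroIndex
  ... | yes _ = 1#
  ... | no  _ = enum u

  nonzeroPart-zeroIndex : nonzeroPart zeroIndex ≈ 1#
  nonzeroPart-zeroIndex with zeroIndex Fin.≟ zeroIndex
  ... | yes _   = refl
  ... | no  z≢z = ⊥-elim (z≢z ≡.refl)

  nonzeroPart-other : ∀ u → u ≢ zeroIndex → nonzeroPart u ≈ enum u
  nonzeroPart-other u u≢z with u Fin.≟ zeroIndex
  ... | yes u≡z = ⊥-elim (u≢z u≡z)
  ... | no  _   = refl

  nonzeroPart-invertible : ∀ u → Σ Carrier λ v → nonzeroPart u * v ≈ 1#
  nonzeroPart-invertible u with u Fin.≟ zeroIndex
  ... | yes _   = 1# , *-identityˡ 1#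
  ... | no  u≢z = inverse (enum u) (u≢z ∘ zeroIndex-unique u)

  -- Fermat's little theorem: y^(q-1) = 1 for y ≠ 0.  Scaling by y permutes the units
  -- nonzeroPart u (u ≠ 0) and fixes 0, so Π_u nonzeroPart u · y = y^q · Π_u nonzeroPart u;
  -- cancel the unit Π_u nonzeroPart u and then y.
  fermat : ∀ y → ¬ (y ≈ 0#) → y ^ (q ∸ 1) ≈ 1#
  fermat y y≉0 = cancel (proj₂ (inverse y y≉0)) (begin
    y * y ^ (q ∸ 1)  ≈⟨ ^-congʳ y q≡1+[q-1] ⟨
    y ^ q            ≈⟨ cancel (proj₂ P-invertible) (trans (*-comm P _) product-equation) ⟩
    y                ≈⟨ *-identityʳ y ⟨
    y * 1#           ∎)
    where
      π = proj₁ (scaling y y≉0)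
      enum-π = proj₂ (scaling y y≉0)
      P = Π.sum nonzeroPart
      P-invertible = sum-invertible nonzeroPart nonzeroPart-invertible

      π-fixes-zero : π ⟨$⟩ʳ zeroIndex ≡ zeroIndex
      π-fixes-zero = zeroIndex-unique _ (trans (enum-π zeroIndex) (trans (*-congˡ enum-zeroIndex) (zeroʳ y)))

      π-scales : ∀ u → u ≢ zeroIndex → nonzeroPart (π ⟨$⟩ʳ u) ≈ y * nonzeroPart u
      π-scales u u≢z = begin
        nonzeroPart (π ⟨$⟩ʳ u) ≈⟨ nonzeroPart-other _ πu≢z ⟩
        enum (π ⟨$⟩ʳ u)        ≈⟨ enum-π u ⟩
        y * enum u             ≈⟨ *-congˡ (nonzeroPart-other u u≢z) ⟨
        y * nonzeroPart u      ∎
        where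
          πu≢z : π ⟨$⟩ʳ u ≢ zeroIndex
          πu≢z πu≡z = u≢z (zeroIndex-unique u (no-zero-divisors y≉0
            (trans (sym (enum-π u)) (trans (reflexive (≡.cong enum πu≡z)) enum-zeroIndex))))

      product-equation : y ^ q * P ≈ P * y
      product-equation = begin
        y ^ q * P                                    ≈⟨ *-congʳ (Π.sum-replicate q {y}) ⟨
        Π.sum {q} (λ _ → y) * P                      ≈⟨ Π.∑-distrib-+ (λ _ → y) nonzeroPart ⟨
        Π.sum (λ u → y * nonzeroPart u)              ≈⟨ *-identityʳ _ ⟨
        Π.sum (λ u → y * nonzeroPart u) * 1#         ≈⟨ *-congˡ (trans (reflexive (≡.cong nonzeroPart π-fixes-zero)) nonzeroPart-zeroIndex) ⟨
        Π.sum (λ u → y * nonzeroPart u) * nonzeroPart (π ⟨$⟩ʳ zeroIndex)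
                                                     ≈⟨ sum-differ-at zeroIndex π-scales ⟨
        Π.sum (λ u → nonzeroPart (π ⟨$⟩ʳ u)) * (y * nonzeroPart zeroIndex)
                                                     ≈⟨ *-cong (Π.sum-permute nonzeroPart π) (*-congˡ (sym nonzeroPart-zeroIndex)) ⟨
        P * (y * 1#)                                 ≈⟨ *-congˡ (*-identityʳ y) ⟩
        P * y                                        ∎

  one-power : ∀ n → 1# ^ n ≈ 1#
  one-power zero    = refl
  one-power (suc n) = trans (*-identityˡ _) (one-power n)

  power-of-nonzero : ∀ {n} → (q ∸ 1) ∣ n → ∀ u → u ≢ zeroIndex → enum u ^ n ≈ 1#
  power-of-nonzero {n} (divides m n≡m[q-1]) u u≢z = begin
    enum u ^ n                  ≡⟨ ≡.cong (enum u ^_) (≡.trans n≡m[q-1] (ℕ.*-comm m (q ∸ 1))) ⟩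
    enum u ^ ((q ∸ 1) ℕ.* m)    ≈⟨ ^-assocʳ (enum u) (q ∸ 1) m ⟨
    (enum u ^ (q ∸ 1)) ^ m      ≈⟨ ^-congˡ m (fermat (enum u) (u≢z ∘ zeroIndex-unique u)) ⟩
    1# ^ m                      ≈⟨ one-power m ⟩
    1#                          ∎

module Embedding {q : ℕ} (F : FiniteField q) (R : CommutativeRing 0ℓ 0ℓ)
                 (ι : CommutativeRing.Carrier (FiniteField.ring F) → CommutativeRing.Carrier R)
                 (hom : IsRingHomomorphism (CommutativeRing.rawRing (FiniteField.ring F))
                                           (CommutativeRing.rawRing R) ι) where
  open CommutativeRing R hiding (zero)
  open IsRingHomomorphism hom
  open import Algebra.Properties.Semiring.Exp semiring using (_^_)
  open import Algebra.Properties.Group +-group using (identityʳ-unique)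
  open import Relation.Binary.Reasoning.Setoid setoid
  open FiniteField F using (enum)
  open ListSum R
  module Fq = CommutativeRing (FiniteField.ring F)
  module Fq^ = Algebra.Properties.Semiring.Exp Fq.semiring
  open FiniteFieldFacts F

  e : Fin q → Carrier
  e u = ι (enum u)

  e-zeroIndex : e zeroIndex ≈ 0#
  e-zeroIndex = trans (⟦⟧-cong enum-zeroIndex) 0#-homo

  ι-^ : ∀ x n → ι (x Fq^.^ n) ≈ ι x ^ n
  ι-^ x zero    = 1#-homo
  ι-^ x (suc n) = trans (*-homo x _) (*-congˡ (ι-^ x n))

  -- q · 1 = 0 in R: translating by 1 permutes F, so Σ_u e u = Σ_u (e u + 1).
  characteristic : ∑[ u ∈ allFin q ] 1# ≈ 0#
  characteristic = identityʳ-unique (∑[ u ∈ allFin q ] e u) _ (sym (begin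
    ∑[ u ∈ allFin q ] e u              ≈⟨ sum-permute σ e ⟨
    ∑[ u ∈ allFin q ] e (σ ⟨$⟩ʳ u)     ≈⟨ sum-cong (allFin q) shifted ⟩
    ∑[ u ∈ allFin q ] (e u + 1#)       ≈⟨ sum-+ (allFin q) e (λ _ → 1#) ⟩
    ∑[ u ∈ allFin q ] e u + ∑[ u ∈ allFin q ] 1# ∎))
    where
      σ = proj₁ translation
      shifted : ∀ u → e (σ ⟨$⟩ʳ u) ≈ e u + 1#
      shifted u = trans (⟦⟧-cong (proj₂ translation u)) (trans (+-homo (enum u) Fq.1#) (+-congˡ 1#-homo))

  scaling-by : ∀ u → u ≢ zeroIndex → Σ (Permutation q q) λ π → ∀ j → e (π ⟨$⟩ʳ j) ≈ e u * e j
  scaling-by u u≢z = π , λ j → trans (⟦⟧-cong (proj₂ (scaling (enum u) nonzero) j)) (*-homo (enum u) (enum j))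
    where
      nonzero = u≢z ∘ zeroIndex-unique u
      π = proj₁ (scaling (enum u) nonzero)

  -- Σ_{u ∈ F_q} u^n = -1 when n ≥ 1 and (q - 1) ∣ n: each of the q - 1 nonzero u
  -- contributes 1 (Fermat), and 0 contributes 0.
  power-sum : ∀ n → (q ∸ 1) ∣ suc n → ∑[ u ∈ allFin q ] (e u ^ suc n) + 1# ≈ 0#
  power-sum n q-1∣1+n = begin
    ∑[ u ∈ allFin q ] (e u ^ suc n) + 1#        ≈⟨ sum-differ-at zeroIndex is-one ⟩
    ∑[ u ∈ allFin q ] 1# + e zeroIndex ^ suc n  ≈⟨ +-cong characteristic (trans (*-congʳ e-zeroIndex) (zeroˡ _)) ⟩
    0# + 0#                                     ≈⟨ +-identityʳ 0# ⟩
    0#                                          ∎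
    where
      is-one : ∀ u → u ≢ zeroIndex → e u ^ suc n ≈ 1#
      is-one u u≢z = trans (sym (ι-^ (enum u) (suc n))) (trans (⟦⟧-cong (power-of-nonzero q-1∣1+n u u≢z)) 1#-homo)

module SpecialValue {q : ℕ} (F : FiniteField q) (R : CommutativeRing 0ℓ 0ℓ)
                    (ι : CommutativeRing.Carrier (FiniteField.ring F) → CommutativeRing.Carrier R)
                    (hom : IsRingHomomorphism (CommutativeRing.rawRing (FiniteField.ring F))
                                              (CommutativeRing.rawRing R) ι)
                    (θ t : CommutativeRing.Carrier R) (β k′ : ℕ) (q-1∣k+β : (q ∸ 1) ∣ (suc k′ ℕ.+ β)) where
  open CommutativeRing R hiding (zero)
  open import Algebra.Properties.Semiring.Exp semiring using (_^_; ^-congˡ; ^-homo-*)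
  open import Algebra.Properties.CommutativeSemiring.Exp commutativeSemiring using (^-distrib-*)
  open import Algebra.Properties.CommutativeSemigroup *-commutativeSemigroup using (interchange)
  open import Data.Vec using (Vec; _∷ʳ_)
  open import Relation.Binary.Reasoning.Setoid setoid
  open import Algebra.Solver.Ring.NaturalCoefficients commutativeSemiring (λ _ _ → nothing)
  open ListSum R
  open FiniteFieldFacts F using (zeroIndex)
  open Embedding F R ι hom
  open PolynomialSums R e

  k : ℕ
  k = suc k′

  weight : Carrier → Carrier → Carrier
  weight a b = a ^ β * b ^ k

  lowerSum : ℕ → Carrier
  lowerSum d = ∑[ c ∈ allVecs q d ] weight (value c t) (value c θ)

  monicSum : ℕ → Carrier
  monicSum d = ∑[ c ∈ allVecs q d ] weight (t ^ d + value c t) (θ ^ d + value c θ)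

  slice : ℕ → Fin q → Carrier
  slice d u = ∑[ c ∈ allVecs q d ] weight (value (c ∷ʳ u) t) (value (c ∷ʳ u) θ)

  slice-zero : ∀ d → slice d zeroIndex ≈ lowerSum d
  slice-zero d = sum-cong (allVecs q d) λ c → *-cong (^-congˡ β (drop-top c t)) (^-congˡ k (drop-top c θ))
    where
      drop-top : ∀ c x → value (c ∷ʳ zeroIndex) x ≈ value c x
      drop-top c x = trans (value-snoc c zeroIndex x)
                           (trans (+-congˡ (trans (*-congʳ e-zeroIndex) (zeroˡ _))) (+-identityʳ _))

  -- Top coefficient u ≠ 0: after rescaling the lower coefficients by e u, these are
  -- e u times the monic polynomials of degree d, so the slice is (e u)^(k+β) · M d.
  slice-nonzero : ∀ d u → u ≢ zeroIndex → slice d u ≈ e u ^ (k ℕ.+ β) * monicSum d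
  slice-nonzero d u u≢z = begin
    slice d u
      ≈⟨ sum-reindex π d _ ⟨
    ∑[ c ∈ allVecs q d ] weight (value (rescale c ∷ʳ u) t) (value (rescale c ∷ʳ u) θ)
      ≈⟨ sum-cong (allVecs q d) (λ c → *-cong (^-congˡ β (scaled-monic c t)) (^-congˡ k (scaled-monic c θ))) ⟩
    ∑[ c ∈ allVecs q d ] weight (e u * (t ^ d + value c t)) (e u * (θ ^ d + value c θ))
      ≈⟨ sum-cong (allVecs q d) (λ c → pull-out _ _) ⟩
    ∑[ c ∈ allVecs q d ] (e u ^ (k ℕ.+ β) * weight (t ^ d + value c t) (θ ^ d + value c θ))
      ≈⟨ sum-*ˡ (allVecs q d) _ _ ⟩
    e u ^ (k ℕ.+ β) * monicSum d ∎
    where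
      π = proj₁ (scaling-by u u≢z)
      rescale : ∀ {d} → Vec (Fin q) d → Vec (Fin q) d
      rescale = mapVec (π ⟨$⟩ʳ_)

      scaled-monic : ∀ c x → value (rescale c ∷ʳ u) x ≈ e u * (x ^ d + value c x)
      scaled-monic c x = begin
        value (rescale c ∷ʳ u) x       ≈⟨ value-snoc (rescale c) u x ⟩
        value (rescale c) x + e u * x ^ d ≈⟨ +-congʳ (value-scale (π ⟨$⟩ʳ_) (e u) (proj₂ (scaling-by u u≢z)) c x) ⟩
        e u * value c x + e u * x ^ d  ≈⟨ +-comm _ _ ⟩
        e u * x ^ d + e u * value c x  ≈⟨ distribˡ (e u) _ _ ⟨
        e u * (x ^ d + value c x)      ∎

      pull-out : ∀ a b → weight (e u * a) (e u * b) ≈ e u ^ (k ℕ.+ β) * weight a b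
      pull-out a b = begin
        (e u * a) ^ β * (e u * b) ^ k        ≈⟨ *-cong (^-distrib-* (e u) a β) (^-distrib-* (e u) b k) ⟩
        (e u ^ β * a ^ β) * (e u ^ k * b ^ k) ≈⟨ interchange _ _ _ _ ⟩
        (e u ^ β * e u ^ k) * weight a b     ≈⟨ *-congʳ (trans (*-comm _ _) (sym (^-homo-* (e u) k β))) ⟩
        e u ^ (k ℕ.+ β) * weight a b         ∎

  -- Splitting by the top coefficient, and using Σ_u (e u)^(k+β) = -1:  Z (d+1) + M d = Z d.
  recurrence : ∀ d → lowerSum (suc d) + monicSum d ≈ lowerSum d
  recurrence d = begin
    lowerSum (suc d) + M
      ≈⟨ +-congʳ (trans (sum-snoc d _) (sum-swap (allVecs q d) (allFin q) _)) ⟩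
    ∑[ u ∈ allFin q ] slice d u + M
      ≈⟨ +-congʳ (trans (sym (+-identityʳ _)) (+-congˡ (sym top-zero))) ⟩
    ∑[ u ∈ allFin q ] slice d u + e zeroIndex ^ (k ℕ.+ β) * M + M
      ≈⟨ +-congʳ (sum-differ-at zeroIndex (slice-nonzero d)) ⟩
    ∑[ u ∈ allFin q ] (e u ^ (k ℕ.+ β) * M) + slice d zeroIndex + M
      ≈⟨ +-congʳ (+-cong (sum-*ʳ (allFin q) M _) (slice-zero d)) ⟩
    s * M + lowerSum d + M
      ≈⟨ solve 3 (λ s m z → s :* m :+ z :+ m := (s :+ con 1) :* m :+ z) refl s M (lowerSum d) ⟩
    (s + 1#) * M + lowerSum d
      ≈⟨ +-congʳ (trans (*-congʳ (power-sum (k′ ℕ.+ β) q-1∣k+β)) (zeroˡ M)) ⟩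
    0# + lowerSum d
      ≈⟨ +-identityˡ _ ⟩
    lowerSum d ∎
    where
      M = monicSum d
      s = ∑[ u ∈ allFin q ] (e u ^ (k ℕ.+ β))
      top-zero : e zeroIndex ^ (k ℕ.+ β) * M ≈ 0#
      top-zero = trans (*-congʳ (trans (*-congʳ e-zeroIndex) (zeroˡ _))) (zeroˡ M)

  telescoping : ∀ d → lowerSum d + sumTo R d monicSum ≈ 0#
  telescoping zero    = trans (+-identityʳ _) (trans (+-identityʳ _) (trans (*-congˡ (zeroˡ _)) (zeroʳ _)))
  telescoping (suc d) = begin
    lowerSum (suc d) + (sumTo R d monicSum + monicSum d) ≈⟨ +-congˡ (+-comm _ _) ⟩
    lowerSum (suc d) + (monicSum d + sumTo R d monicSum) ≈⟨ +-assoc _ _ _ ⟨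
    lowerSum (suc d) + monicSum d + sumTo R d monicSum   ≈⟨ +-congʳ (recurrence d) ⟩
    lowerSum d + sumTo R d monicSum                      ≈⟨ telescoping d ⟩
    0#                                                   ∎

  monicSum-vanishes : ∀ d → β ℕ.+ k ℕ.< d → monicSum d ≈ 0#
  monicSum-vanishes d β+k<d = vanishing characteristic d β k β+k<d t θ (t ^ d) (θ ^ d)

  lowerSum-vanishes : ∀ d → β ℕ.+ k ℕ.< d → lowerSum d ≈ 0#
  lowerSum-vanishes d β+k<d = unshifted d β k t θ (vanishing characteristic d β k β+k<d t θ 0# 0#)

  monicSum-finite-zero : FinSuppSumZero R monicSum
  monicSum-finite-zero = N , (λ d N≤d → monicSum-vanishes d N≤d) , (begin
    sumTo R N monicSum                 ≈⟨ +-identityˡ _ ⟨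
    0# + sumTo R N monicSum            ≈⟨ +-congʳ (lowerSum-vanishes N ≤-refl) ⟨
    lowerSum N + sumTo R N monicSum    ≈⟨ telescoping N ⟩
    0#                                 ∎)
    where
      N = suc (β ℕ.+ k)

  degreeSum≈monicSum : ∀ d → degreeSum F R ι θ t β k d ≈ monicSum d
  degreeSum≈monicSum d = sum-cong (allVecs q d) λ c →
    *-cong (trans (reflexive (pow≡^ _ β)) (^-congˡ β (evalMonic-value c t)))
           (trans (reflexive (pow≡^ _ k)) (^-congˡ k (evalMonic-value c θ)))
    where
      pow≡^ : ∀ x n → pow R x n ≡ x ^ n
      pow≡^ x zero    = ≡.refl
      pow≡^ x (suc n) = ≡.cong (x *_) (pow≡^ x n)

open import Data.Nat using (_<_; _≤_; _+_; _^_)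
open import Data.Nat.Primality using (Prime)

-- Proposition 5.4: for λ = k > β with λ ≡ -β (mod q - 1), the special value
-- L(χ_t^β, -λ) = Σ_e Σ_{a ∈ A₊(e)} a(t)^β a^λ is a finite sum equal to 0.
proposition5p4 : (p m₀ q : ℕ) → Prime p → 1 ≤ m₀ → q ≡ p ^ m₀ →
                 (F : FiniteField q) → (R : CommutativeRing 0ℓ 0ℓ) →
                 (ι : CommutativeRing.Carrier (FiniteField.ring F) → CommutativeRing.Carrier R) →
                 IsRingHomomorphism (CommutativeRing.rawRing (FiniteField.ring F)) (CommutativeRing.rawRing R) ι →
                 (θ t : CommutativeRing.Carrier R) → (β k : ℕ) → β < k → (q ∸ 1) ∣ (k + β) →
                 FinSuppSumZero R (degreeSum F R ι θ t β k)
proposition5p4 p m₀ q _ _ _ F R ι hom θ t β zero     () _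
proposition5p4 p m₀ q _ _ _ F R ι hom θ t β (suc k′) _  q-1∣k+β =
  finSuppSumZero-cong degreeSum≈monicSum monicSum-finite-zero
  where
    open SpecialValue F R ι hom θ t β k′ q-1∣k+β
    open ListSum R using (finSuppSumZero-cong)
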